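{- Let $A,B\in\mathbb{Z}$ with $AB\neq0$ and $k\in\{1,2\}$. Let $f(x)=x^6+Ax^{2k}+B$ and $\widehat{h}(x)=x^3+(-1)^kAB^{k-1}x^{3-k}-B^2$. If $f(x)$ is irreducible over $\mathbb{Q}$, then $\widehat{h}(x)$ is irreducible over $\mathbb{Q}$. -}

module Defs where

open import Data.Nat as ℕ using (ℕ; zero; suc; _<_; _≤_; _∸_)
open import Data.Integer as ℤ using (ℤ)
open import Data.Rational using (ℚ; 0ℚ; _+_; _*_; _/_)
open import Data.List using (List; map; foldr; upTo)
open import Data.Product using (∃; _×_)
open import Relation.Nullary using (¬_; yes; no)
open import Relation.Binary.PropositionalEquality using (_≡_; _≢_)

-- A polynomial with rational coefficients, given by its coefficient
-- function: Poly p means "p i is the coefficient of x^i".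
Poly : Set
Poly = ℕ → ℚ

ℤ→ℚ : ℤ → ℚ
ℤ→ℚ z = z / 1

mono : ℚ → ℕ → Poly
mono c n i with i ℕ.≟ n
... | yes _ = c
... | no _  = 0ℚ

_⊕_ : Poly → Poly → Poly
(p ⊕ q) i = p i + q i
infixl 6 _⊕_

_⊗_ : Poly → Poly → Poly
(p ⊗ q) n = foldr _+_ 0ℚ (map (λ i → p i * q (n ∸ i)) (upTo (suc n)))
infixl 7 _⊗_

-- p has degree exactly d (in particular p has finite support).
HasDegree : Poly → ℕ → Set
HasDegree p d = (p d ≢ 0ℚ) × (∀ i → d < i → p i ≡ 0ℚ)

Nonconstant : Poly → Set
Nonconstant p = ∃ λ d → (1 ≤ d) × HasDegree p d

Irreducible : Poly → Set
Irreducible f = Nonconstant f ×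
  ¬ (∃ λ g → ∃ λ h → Nonconstant g × Nonconstant h × (∀ n → f n ≡ (g ⊗ h) n))

module Submission where

-- A reducible cubic has a rational root r. For the resolvent
-- R(x) = x³ − b x² + a c x − c² that root is nonzero because R(0) = −c² ≠ 0,
-- and y = −c/r is a root of S(z) = z³ + a z² + b z + c, because
-- r³ S(y) = c R(r) + (y r + c) Q for an explicit polynomial Q. Hence x² − y
-- divides S(x²) = x⁶ + a x⁴ + b x² + c. The paper's f and ĥ are S(x²) and R
-- for (a, b, c) = (0, A, B) when k = 1 and (A, 0, B) when k = 2.

open import Data.Fin.Patterns using (0F; 1F; 2F; 3F)
open import Data.Integer as ℤ using (ℤ; 0ℤ; 1ℤ)
open import Data.Nat as ℕ using (ℕ; zero; suc; _∸_; z≤n; s≤s)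
open import Data.Sum using (_⊎_; inj₁; inj₂; [_,_]′)
open import Function using (_∘_)
open import Relation.Binary.PropositionalEquality

open import Defs

-- ℚ arithmetic is opened only inside this module: the statement of lemma2p1
-- uses the integer operators unqualified.
module _ where
  import Data.Integer.GCD as ℤ
  import Data.Integer.Properties as ℤ
  open import Data.Empty using (⊥-elim)
  open import Data.List using (foldr; map; upTo)
  open import Data.List.Properties using (map-applyUpTo)
  import Data.Nat.Properties as ℕ
  open import Data.Product using (∃; _×_; _,_; proj₂)
  open import Data.Rational using (ℚ; 0ℚ; 1ℚ; _+_; _*_; -_; _-_; 1/_; ↥_; ≢-nonZero; toℚᵘ)
  open import Data.Rational.Properties
    using ( _≟_; 1≢0; +-identityˡ; +-identityʳ; *-identityˡ; *-assoc; *-zeroˡ; *-zeroʳ; *-inverseˡ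
          ; neg-injective; +-*-commutativeRing; toℚᵘ-injective; toℚᵘ-homo-*; toℚᵘ-fromℚᵘ
          ; p≡0⇒↥p≡0; ↥-/)
  import Data.Rational.Unnormalised as ℚᵘ
  import Data.Rational.Unnormalised.Properties as ℚᵘ
  open import Data.Vec using (Vec; _∷_; [])
  open import Level using (0ℓ)
  open import Relation.Binary.Definitions using (tri<; tri≈; tri>)
  open import Relation.Nullary using (yes; no)
  open import Relation.Nullary.Decidable using (dec⇒maybe)
  open import Tactic.RingSolver using (solve-∀)
  import Tactic.RingSolver.Core.AlmostCommutativeRing as ACR
  open import Tactic.RingSolver.Core.Expression using (Expr; Κ; Ι; ⊝_)
    renaming (_⊕_ to _:+_; _⊗_ to _:*_)

  ℚ-ring : ACR.AlmostCommutativeRing 0ℓ 0ℓ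
  ℚ-ring = ACR.fromCommutativeRing +-*-commutativeRing (λ x → dec⇒maybe (0ℚ ≟ x))

  open import Tactic.RingSolver.NonReflective ℚ-ring using (module Ops)
  open Ops using (prove)

  p*q≡0⇒p≡0∨q≡0 : ∀ p q → p * q ≡ 0ℚ → p ≡ 0ℚ ⊎ q ≡ 0ℚ
  p*q≡0⇒p≡0∨q≡0 p q pq≡0 with p ≟ 0ℚ
  ... | yes p≡0 = inj₁ p≡0
  ... | no  p≢0 = inj₂ (begin
    q                 ≡⟨ sym (*-identityˡ q) ⟩
    1ℚ * q            ≡⟨ cong (_* q) (sym (*-inverseˡ p)) ⟩
    (1/ p * p) * q    ≡⟨ *-assoc (1/ p) p q ⟩
    1/ p * (p * q)    ≡⟨ cong (1/ p *_) pq≡0 ⟩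
    1/ p * 0ℚ         ≡⟨ *-zeroʳ (1/ p) ⟩
    0ℚ                ∎)
    where
    open ≡-Reasoning
    instance _ = ≢-nonZero p≢0

  *-≢0 : ∀ {p q} → p ≢ 0ℚ → q ≢ 0ℚ → p * q ≢ 0ℚ
  *-≢0 p≢0 q≢0 = [ p≢0 , q≢0 ]′ ∘ p*q≡0⇒p≡0∨q≡0 _ _

  DegreeAtMost : Poly → ℕ → Set
  DegreeAtMost p d = ∀ i → d ℕ.< i → p i ≡ 0ℚ

  NontrivialFactorisation : Poly → Set
  NontrivialFactorisation f = ∃ λ g → ∃ λ h → Nonconstant g × Nonconstant h × f ≗ g ⊗ h

  mono-zero : ∀ n i → mono 0ℚ n i ≡ 0ℚ
  mono-zero n i with i ℕ.≟ n
  ... | yes _ = refl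
  ... | no  _ = refl

  ⊕-mono-zero : ∀ p n → p ⊕ mono 0ℚ n ≗ p
  ⊕-mono-zero p n i = trans (cong (p i +_) (mono-zero n i)) (+-identityʳ (p i))

  DegreeAtMost-mono : ∀ c {n d} → n ℕ.≤ d → DegreeAtMost (mono c n) d
  DegreeAtMost-mono c {n} n≤d i d<i with i ℕ.≟ n
  ... | yes refl = ⊥-elim (ℕ.<⇒≱ d<i n≤d)
  ... | no  _    = refl

  DegreeAtMost-⊕ : ∀ {p q d} → DegreeAtMost p d → DegreeAtMost q d → DegreeAtMost (p ⊕ q) d
  DegreeAtMost-⊕ p≤d q≤d i d<i = cong₂ _+_ (p≤d i d<i) (q≤d i d<i)

  DegreeAtMost-∘suc : ∀ {p d} → DegreeAtMost p (suc d) → DegreeAtMost (p ∘ suc) d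
  DegreeAtMost-∘suc p≤1+d i d<i = p≤1+d (suc i) (s≤s d<i)

  HasDegree-resp-≗ : ∀ {p q d} → p ≗ q → HasDegree p d → HasDegree q d
  HasDegree-resp-≗ p≗q (pd≢0 , p≤d) =
    (λ qd≡0 → pd≢0 (trans (p≗q _) qd≡0)) , (λ i d<i → trans (sym (p≗q i)) (p≤d i d<i))

  Irreducible-resp-≗ : ∀ {p q} → p ≗ q → Irreducible p → Irreducible q
  Irreducible-resp-≗ p≗q ((d , 1≤d , deg) , irreducible) =
    (d , 1≤d , HasDegree-resp-≗ p≗q deg) ,
    λ (g , h , g-nc , h-nc , q≗gh) → irreducible (g , h , g-nc , h-nc , λ i → trans (p≗q i) (q≗gh i))

  ⊗-zero : ∀ p q → (p ⊗ q) 0 ≡ p 0 * q 0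
  ⊗-zero p q = +-identityʳ (p 0 * q 0)

  ⊗-suc : ∀ p q k → (p ⊗ q) (suc k) ≡ p 0 * q (suc k) + ((p ∘ suc) ⊗ q) k
  ⊗-suc p q k = cong (p 0 * q (suc k) +_) (trans
    (cong (foldr _+_ 0ℚ) (map-applyUpTo suc (λ i → p i * q (suc k ∸ i)) (suc k)))
    (sym (cong (foldr _+_ 0ℚ) (map-applyUpTo (λ i → i) (λ i → p (suc i) * q (k ∸ i)) (suc k)))))

  ⊗-annihilˡ : ∀ {p} q → (∀ i → p i ≡ 0ℚ) → ∀ k → (p ⊗ q) k ≡ 0ℚ
  ⊗-annihilˡ {p} q p≡0 zero =
    trans (⊗-zero p q) (trans (cong (_* q 0) (p≡0 0)) (*-zeroˡ (q 0)))
  ⊗-annihilˡ {p} q p≡0 (suc k) = trans (⊗-suc p q k) (cong₂ _+_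
    (trans (cong (_* q (suc k)) (p≡0 0)) (*-zeroˡ (q (suc k))))
    (⊗-annihilˡ q (p≡0 ∘ suc) k))

  ⊗-constantˡ : ∀ {p} q → DegreeAtMost p 0 → ∀ k → (p ⊗ q) k ≡ p 0 * q k
  ⊗-constantˡ {p} q p≤0 zero    = ⊗-zero p q
  ⊗-constantˡ {p} q p≤0 (suc k) = trans (⊗-suc p q k) (trans
    (cong (p 0 * q (suc k) +_) (⊗-annihilˡ q (λ i → p≤0 (suc i) (s≤s z≤n)) k))
    (+-identityʳ (p 0 * q (suc k))))

  DegreeAtMost-⊗ : ∀ {p q} m n → DegreeAtMost p m → DegreeAtMost q n → DegreeAtMost (p ⊗ q) (m ℕ.+ n)
  DegreeAtMost-⊗ {p} {q} zero n p≤0 q≤n i n<i =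
    trans (⊗-constantˡ q p≤0 i) (trans (cong (p 0 *_) (q≤n i n<i)) (*-zeroʳ (p 0)))
  DegreeAtMost-⊗ {p} {q} (suc m) n p≤m q≤n (suc k) (s≤s m+n<k) = trans (⊗-suc p q k) (cong₂ _+_
    (trans (cong (p 0 *_) (q≤n (suc k) n<1+k)) (*-zeroʳ (p 0)))
    (DegreeAtMost-⊗ m n (DegreeAtMost-∘suc p≤m) q≤n k m+n<k))
    where
    n<1+k : n ℕ.< suc k
    n<1+k = s≤s (ℕ.≤-trans (ℕ.m≤n+m n m) (ℕ.<⇒≤ m+n<k))

  ⊗-leading : ∀ {p q} m n → DegreeAtMost p m → DegreeAtMost q n → (p ⊗ q) (m ℕ.+ n) ≡ p m * q n
  ⊗-leading {p} {q} zero    n p≤0 q≤n = ⊗-constantˡ q p≤0 n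
  ⊗-leading {p} {q} (suc m) n p≤m q≤n = begin
    (p ⊗ q) (suc m ℕ.+ n)                                 ≡⟨ ⊗-suc p q (m ℕ.+ n) ⟩
    p 0 * q (suc m ℕ.+ n) + ((p ∘ suc) ⊗ q) (m ℕ.+ n)    ≡⟨ cong₂ _+_ (cong (p 0 *_) (q≤n _ (s≤s (ℕ.m≤n+m n m))))
                                                               (⊗-leading m n (DegreeAtMost-∘suc p≤m) q≤n) ⟩
    p 0 * 0ℚ + p (suc m) * q n                            ≡⟨ cong (_+ p (suc m) * q n) (*-zeroʳ (p 0)) ⟩
    0ℚ + p (suc m) * q n                                  ≡⟨ +-identityˡ (p (suc m) * q n) ⟩
    p (suc m) * q n                                       ∎
    where open ≡-Reasoning

  HasDegree-⊗ : ∀ {p q m n} → HasDegree p m → HasDegree q n → HasDegree (p ⊗ q) (m ℕ.+ n)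
  HasDegree-⊗ {m = m} {n} (pm≢0 , p≤m) (qn≢0 , q≤n) =
    (λ lead≡0 → *-≢0 pm≢0 qn≢0 (trans (sym (⊗-leading m n p≤m q≤n)) lead≡0)) ,
    DegreeAtMost-⊗ m n p≤m q≤n

  HasDegree-unique : ∀ {p q m n} → p ≗ q → HasDegree p m → HasDegree q n → m ≡ n
  HasDegree-unique {m = m} {n} p≗q (pm≢0 , p≤m) (qn≢0 , q≤n) with ℕ.<-cmp m n
  ... | tri< m<n _ _ = ⊥-elim (qn≢0 (trans (sym (p≗q n)) (p≤m n m<n)))
  ... | tri≈ _ m≡n _ = m≡n
  ... | tri> _ _ n<m = ⊥-elim (pm≢0 (trans (p≗q m) (q≤n m n<m)))

  -- The value at r of the truncation of p to degree d.
  eval : ℕ → Poly → ℚ → ℚ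
  eval zero    p r = p 0
  eval (suc d) p r = p 0 + r * eval d (p ∘ suc) r

  eval-cong : ∀ {p q} d r → p ≗ q → eval d p r ≡ eval d q r
  eval-cong zero    r p≗q = p≗q 0
  eval-cong (suc d) r p≗q = cong₂ (λ u v → u + r * v) (p≗q 0) (eval-cong d r (p≗q ∘ suc))

  eval-⊕ : ∀ p q d r → eval d (p ⊕ q) r ≡ eval d p r + eval d q r
  eval-⊕ p q zero    r = refl
  eval-⊕ p q (suc d) r = trans
    (cong (λ v → p 0 + q 0 + r * v) (eval-⊕ (p ∘ suc) (q ∘ suc) d r))
    (distrib (p 0) (q 0) r (eval d (p ∘ suc) r) (eval d (q ∘ suc) r))
    where
    distrib : ∀ a b r u v → a + b + r * (u + v) ≡ (a + r * u) + (b + r * v)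
    distrib = solve-∀ ℚ-ring

  eval-scale : ∀ c p d r → eval d (λ i → c * p i) r ≡ c * eval d p r
  eval-scale c p zero    r = refl
  eval-scale c p (suc d) r = trans
    (cong (λ v → c * p 0 + r * v) (eval-scale c (p ∘ suc) d r))
    (distrib c (p 0) r (eval d (p ∘ suc) r))
    where
    distrib : ∀ c a r u → c * a + r * (c * u) ≡ c * (a + r * u)
    distrib = solve-∀ ℚ-ring

  eval-extend : ∀ {p d e} r → DegreeAtMost p d → d ℕ.≤ e → eval e p r ≡ eval d p r
  eval-extend {p} {zero}  {zero}  r p≤0 _ = refl
  eval-extend {p} {zero}  {suc e} r p≤0 _ = begin
    p 0 + r * eval e (p ∘ suc) r   ≡⟨ cong (λ v → p 0 + r * v) (eval-extend {e = e} r (λ i _ → p≤0 (suc i) (s≤s z≤n)) z≤n) ⟩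
    p 0 + r * p 1                  ≡⟨ cong (λ v → p 0 + r * v) (p≤0 1 (s≤s z≤n)) ⟩
    p 0 + r * 0ℚ                   ≡⟨ cong (p 0 +_) (*-zeroʳ r) ⟩
    p 0 + 0ℚ                       ≡⟨ +-identityʳ (p 0) ⟩
    p 0                            ∎
    where open ≡-Reasoning
  eval-extend {p} {suc d} {suc e} r p≤d (s≤s d≤e) =
    cong (λ v → p 0 + r * v) (eval-extend r (DegreeAtMost-∘suc p≤d) d≤e)

  eval-⊗ : ∀ {p q} m n r → DegreeAtMost p m → DegreeAtMost q n →
           eval (m ℕ.+ n) (p ⊗ q) r ≡ eval m p r * eval n q r
  eval-⊗ {p} {q} zero n r p≤0 q≤n = trans (eval-cong n r (⊗-constantˡ q p≤0)) (eval-scale (p 0) q n r)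
  eval-⊗ {p} {q} (suc m) n r p≤m q≤n = begin
    (p ⊗ q) 0 + r * eval (m ℕ.+ n) ((p ⊗ q) ∘ suc) r
      ≡⟨ cong₂ (λ u v → u + r * v) (⊗-zero p q) (eval-cong (m ℕ.+ n) r (⊗-suc p q)) ⟩
    p 0 * q 0 + r * eval (m ℕ.+ n) ((λ k → p 0 * q (suc k)) ⊕ ((p ∘ suc) ⊗ q)) r
      ≡⟨ cong (λ v → p 0 * q 0 + r * v) (eval-⊕ _ _ (m ℕ.+ n) r) ⟩
    p 0 * q 0 + r * (eval (m ℕ.+ n) (λ k → p 0 * q (suc k)) r + eval (m ℕ.+ n) ((p ∘ suc) ⊗ q) r)
      ≡⟨ cong₂ (λ u v → p 0 * q 0 + r * (u + v))
           (eval-scale (p 0) (q ∘ suc) (m ℕ.+ n) r) (eval-⊗ m n r (DegreeAtMost-∘suc p≤m) q≤n) ⟩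
    p 0 * q 0 + r * (p 0 * eval (m ℕ.+ n) (q ∘ suc) r + eval m (p ∘ suc) r * eval n q r)
      ≡⟨ regroup (p 0) (q 0) r (eval (m ℕ.+ n) (q ∘ suc) r) (eval m (p ∘ suc) r) (eval n q r) ⟩
    p 0 * eval (suc (m ℕ.+ n)) q r + r * eval m (p ∘ suc) r * eval n q r
      ≡⟨ cong (λ v → p 0 * v + r * eval m (p ∘ suc) r * eval n q r) (eval-extend r q≤n (ℕ.m≤n+m n (suc m))) ⟩
    p 0 * eval n q r + r * eval m (p ∘ suc) r * eval n q r
      ≡⟨ factor (p 0) r (eval m (p ∘ suc) r) (eval n q r) ⟩
    (p 0 + r * eval m (p ∘ suc) r) * eval n q r
      ∎
    where
    open ≡-Reasoning
    regroup : ∀ a b r u v w → a * b + r * (a * u + v * w) ≡ a * (b + r * u) + r * v * w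
    regroup = solve-∀ ℚ-ring
    factor : ∀ a r v w → a * w + r * v * w ≡ (a + r * v) * w
    factor = solve-∀ ℚ-ring

  linear-root : ∀ {p} → HasDegree p 1 → ∃ λ r → eval 1 p r ≡ 0ℚ
  linear-root {p} (p₁≢0 , _) = - p 0 * 1/ p 1 , (begin
    p 0 + (- p 0 * 1/ p 1) * p 1   ≡⟨ regroup (p 0) (1/ p 1) (p 1) ⟩
    p 0 - p 0 * (1/ p 1 * p 1)     ≡⟨ cong (λ v → p 0 - p 0 * v) (*-inverseˡ (p 1)) ⟩
    p 0 - p 0 * 1ℚ                 ≡⟨ cancel (p 0) ⟩
    0ℚ                             ∎)
    where
    open ≡-Reasoning
    instance _ = ≢-nonZero p₁≢0
    regroup : ∀ a u b → a + (- a * u) * b ≡ a - a * (u * b)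
    regroup = solve-∀ ℚ-ring
    cancel : ∀ a → a - a * 1ℚ ≡ 0ℚ
    cancel = solve-∀ ℚ-ring

  summands-of-3 : ∀ {m n} → 1 ℕ.≤ m → 1 ℕ.≤ n → 3 ≡ m ℕ.+ n → m ≡ 1 ⊎ n ≡ 1
  summands-of-3 {1}                       _ _ _  = inj₁ refl
  summands-of-3 {2} {1}                   _ _ _  = inj₂ refl
  summands-of-3 {2} {suc (suc _)}         _ _ ()
  summands-of-3 {3} {suc _}               _ _ ()
  summands-of-3 {suc (suc (suc (suc _)))} _ _ ()

  cubic-factorisation⇒root : ∀ {P} → HasDegree P 3 → NontrivialFactorisation P → ∃ λ r → eval 3 P r ≡ 0ℚ
  cubic-factorisation⇒root {P} P-deg (g , h , (m , 1≤m , g-deg) , (n , 1≤n , h-deg) , P≗gh) =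
    root-of-factor (summands-of-3 1≤m 1≤n 3≡m+n)
    where
    open ≡-Reasoning
    3≡m+n : 3 ≡ m ℕ.+ n
    3≡m+n = HasDegree-unique P≗gh P-deg (HasDegree-⊗ g-deg h-deg)

    eval-P : ∀ r → eval 3 P r ≡ eval m g r * eval n h r
    eval-P r = begin
      eval 3 P r               ≡⟨ eval-cong 3 r P≗gh ⟩
      eval 3 (g ⊗ h) r         ≡⟨ cong (λ d → eval d (g ⊗ h) r) 3≡m+n ⟩
      eval (m ℕ.+ n) (g ⊗ h) r ≡⟨ eval-⊗ m n r (proj₂ g-deg) (proj₂ h-deg) ⟩
      eval m g r * eval n h r  ∎

    root-of-factor : m ≡ 1 ⊎ n ≡ 1 → ∃ λ r → eval 3 P r ≡ 0ℚ
    root-of-factor (inj₁ refl) =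
      let r , g[r]≡0 = linear-root g-deg in
      r , trans (eval-P r) (trans (cong (_* eval n h r) g[r]≡0) (*-zeroˡ (eval n h r)))
    root-of-factor (inj₂ refl) =
      let r , h[r]≡0 = linear-root h-deg in
      r , trans (eval-P r) (trans (cong (eval m g r *_) h[r]≡0) (*-zeroʳ (eval m g r)))

  evenSextic : ℚ → ℚ → ℚ → Poly
  evenSextic a b c = mono 1ℚ 6 ⊕ mono a 4 ⊕ mono b 2 ⊕ mono c 0

  resolventCubic : ℚ → ℚ → ℚ → Poly
  resolventCubic a b c = mono 1ℚ 3 ⊕ mono (- b) 2 ⊕ mono (a * c) 1 ⊕ mono (- (c * c)) 0

  -- Copies of mono, _⊕_, _⊗_ and eval on ring-solver expressions: at a literal index
  -- their denotation unfolds to that of the originals, so a coefficient identity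
  -- between concrete polynomials is an instance of prove.
  module _ {v : ℕ} where
    monoᴱ : Expr ℚ v → ℕ → ℕ → Expr ℚ v
    monoᴱ c n i with i ℕ.≟ n
    ... | yes _ = c
    ... | no  _ = Κ 0ℚ

    infixl 6 _⊕ᴱ_
    _⊕ᴱ_ : (ℕ → Expr ℚ v) → (ℕ → Expr ℚ v) → ℕ → Expr ℚ v
    (p ⊕ᴱ q) i = p i :+ q i

    infixl 7 _⊗ᴱ_
    _⊗ᴱ_ : (ℕ → Expr ℚ v) → (ℕ → Expr ℚ v) → ℕ → Expr ℚ v
    (p ⊗ᴱ q) n = foldr _:+_ (Κ 0ℚ) (map (λ i → p i :* q (n ∸ i)) (upTo (suc n)))

    evalᴱ : ℕ → (ℕ → Expr ℚ v) → Expr ℚ v → Expr ℚ v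
    evalᴱ zero    p r = p 0
    evalᴱ (suc d) p r = p 0 :+ r :* evalᴱ d (p ∘ suc) r

  cubic-root⇒evenSextic-factorisation : ∀ {a b c} y → y * y * y + a * (y * y) + b * y + c ≡ 0ℚ →
                                        NontrivialFactorisation (evenSextic a b c)
  cubic-root⇒evenSextic-factorisation {a} {b} {c} y S[y]≡0 =
    G , H , (2 , s≤s z≤n , G-deg) , (4 , s≤s z≤n , H-deg) , coefficients
    where
    open ≡-Reasoning
    G H : Poly
    G = mono (- y) 0 ⊕ mono 1ℚ 2
    H = mono (y * y + a * y + b) 0 ⊕ mono (y + a) 2 ⊕ mono 1ℚ 4

    G-deg : HasDegree G 2
    G-deg = 1≢0 , DegreeAtMost-⊕ (DegreeAtMost-mono _ z≤n) (DegreeAtMost-mono _ ℕ.≤-refl)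
    H-deg : HasDegree H 4
    H-deg = 1≢0 , DegreeAtMost-⊕ (DegreeAtMost-⊕ (DegreeAtMost-mono _ z≤n) (DegreeAtMost-mono _ (ℕ.m≤m+n 2 2)))
                                  (DegreeAtMost-mono _ ℕ.≤-refl)

    ρ : Vec ℚ 4
    ρ = y ∷ a ∷ b ∷ c ∷ []
    yᴱ aᴱ bᴱ cᴱ : Expr ℚ 4
    yᴱ = Ι 0F
    aᴱ = Ι 1F
    bᴱ = Ι 2F
    cᴱ = Ι 3F
    Sᴱ Gᴱ Hᴱ : ℕ → Expr ℚ 4
    Sᴱ = monoᴱ (Κ 1ℚ) 6 ⊕ᴱ monoᴱ aᴱ 4 ⊕ᴱ monoᴱ bᴱ 2 ⊕ᴱ monoᴱ cᴱ 0
    Gᴱ = monoᴱ (⊝ yᴱ) 0 ⊕ᴱ monoᴱ (Κ 1ℚ) 2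
    Hᴱ = monoᴱ (yᴱ :* yᴱ :+ aᴱ :* yᴱ :+ bᴱ) 0 ⊕ᴱ monoᴱ (yᴱ :+ aᴱ) 2 ⊕ᴱ monoᴱ (Κ 1ℚ) 4

    c≡-y[y²+ay+b] : c ≡ - y * (y * y + a * y + b)
    c≡-y[y²+ay+b] = begin
      c                                                           ≡⟨ expand y a b c ⟩
      (y * y * y + a * (y * y) + b * y + c) + - y * (y * y + a * y + b)
                                                                  ≡⟨ cong (_+ - y * (y * y + a * y + b)) S[y]≡0 ⟩
      0ℚ + - y * (y * y + a * y + b)                              ≡⟨ +-identityˡ _ ⟩
      - y * (y * y + a * y + b)                                   ∎
      where
      expand : ∀ y a b c → c ≡ (y * y * y + a * (y * y) + b * y + c) + - y * (y * y + a * y + b)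
      expand = solve-∀ ℚ-ring

    coefficients : evenSextic a b c ≗ G ⊗ H
    coefficients 0 = begin
      evenSextic a b c 0         ≡⟨ prove ρ (Sᴱ 0) cᴱ refl ⟩
      c                          ≡⟨ c≡-y[y²+ay+b] ⟩
      - y * (y * y + a * y + b)  ≡⟨ prove ρ (⊝ yᴱ :* (yᴱ :* yᴱ :+ aᴱ :* yᴱ :+ bᴱ)) ((Gᴱ ⊗ᴱ Hᴱ) 0) refl ⟩
      (G ⊗ H) 0                  ∎
    coefficients 1 = prove ρ (Sᴱ 1) ((Gᴱ ⊗ᴱ Hᴱ) 1) refl
    coefficients 2 = prove ρ (Sᴱ 2) ((Gᴱ ⊗ᴱ Hᴱ) 2) refl
    coefficients 3 = prove ρ (Sᴱ 3) ((Gᴱ ⊗ᴱ Hᴱ) 3) refl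
    coefficients 4 = prove ρ (Sᴱ 4) ((Gᴱ ⊗ᴱ Hᴱ) 4) refl
    coefficients 5 = prove ρ (Sᴱ 5) ((Gᴱ ⊗ᴱ Hᴱ) 5) refl
    coefficients 6 = prove ρ (Sᴱ 6) ((Gᴱ ⊗ᴱ Hᴱ) 6) refl
    coefficients i@(suc (suc (suc (suc (suc (suc (suc j))))))) =
      sym (DegreeAtMost-⊗ 2 4 (proj₂ G-deg) (proj₂ H-deg) i (ℕ.m≤m+n 7 j))

  resolventCubic-root⇒cubic-root : ∀ {a b c} r → c ≢ 0ℚ → eval 3 (resolventCubic a b c) r ≡ 0ℚ →
                                   ∃ λ y → y * y * y + a * (y * y) + b * y + c ≡ 0ℚ
  resolventCubic-root⇒cubic-root {a} {b} {c} r c≢0 R[r]≡0 = y , S[y]≡0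
    where
    open ≡-Reasoning
    R : Poly
    R = resolventCubic a b c

    R-value : ∀ x → eval 3 R x ≡ x * (x * x - b * x + a * c) - c * c
    R-value x = prove (x ∷ a ∷ b ∷ c ∷ []) (evalᴱ 3 Rᴱ xᴱ)
                      (xᴱ :* (xᴱ :* xᴱ :+ ⊝ (bᴱ :* xᴱ) :+ aᴱ :* cᴱ) :+ ⊝ (cᴱ :* cᴱ)) refl
      where
      xᴱ aᴱ bᴱ cᴱ : Expr ℚ 4
      xᴱ = Ι 0F
      aᴱ = Ι 1F
      bᴱ = Ι 2F
      cᴱ = Ι 3F
      Rᴱ : ℕ → Expr ℚ 4
      Rᴱ = monoᴱ (Κ 1ℚ) 3 ⊕ᴱ monoᴱ (⊝ bᴱ) 2 ⊕ᴱ monoᴱ (aᴱ :* cᴱ) 1 ⊕ᴱ monoᴱ (⊝ (cᴱ :* cᴱ)) 0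

    r≢0 : r ≢ 0ℚ
    r≢0 r≡0 = *-≢0 c≢0 c≢0 (neg-injective (begin
      - (c * c)                                   ≡⟨ at-0 (b * 0ℚ) (a * c) c ⟨
      0ℚ * (0ℚ * 0ℚ - b * 0ℚ + a * c) - c * c     ≡⟨ R-value 0ℚ ⟨
      eval 3 R 0ℚ                                 ≡⟨ cong (eval 3 R) r≡0 ⟨
      eval 3 R r                                  ≡⟨ R[r]≡0 ⟩
      0ℚ                                          ∎))
      where
      at-0 : ∀ u v c → 0ℚ * (0ℚ * 0ℚ - u + v) - c * c ≡ - (c * c)
      at-0 = solve-∀ ℚ-ring

    instance _ = ≢-nonZero r≢0

    y : ℚ
    y = - c * 1/ r

    yr+c≡0 : y * r + c ≡ 0ℚ
    yr+c≡0 = begin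
      (- c * 1/ r) * r + c   ≡⟨ regroup c (1/ r) r ⟩
      c * (1ℚ - 1/ r * r)    ≡⟨ cong (λ v → c * (1ℚ - v)) (*-inverseˡ r) ⟩
      c * (1ℚ - 1ℚ)          ≡⟨ *-zeroʳ c ⟩
      0ℚ                     ∎
      where
      regroup : ∀ c u r → (- c * u) * r + c ≡ c * (1ℚ - u * r)
      regroup = solve-∀ ℚ-ring

    r³S[y]≡0 : r * r * r * (y * y * y + a * (y * y) + b * y + c) ≡ 0ℚ
    r³S[y]≡0 = begin
      r * r * r * (y * y * y + a * (y * y) + b * y + c)
        ≡⟨ identity y r a b c ⟩
      c * (r * (r * r - b * r + a * c) - c * c) + (y * r + c) * Q
        ≡⟨ cong₂ (λ u v → c * u + v * Q) (trans (sym (R-value r)) R[r]≡0) yr+c≡0 ⟩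
      c * 0ℚ + 0ℚ * Q
        ≡⟨ cong₂ _+_ (*-zeroʳ c) (*-zeroˡ Q) ⟩
      0ℚ
        ∎
      where
      Q : ℚ
      Q = (y * r) * (y * r) - (y * r) * c + c * c + a * r * (y * r - c) + b * r * r
      identity : ∀ y r a b c →
        r * r * r * (y * y * y + a * (y * y) + b * y + c) ≡
        c * (r * (r * r - b * r + a * c) - c * c) +
        (y * r + c) * ((y * r) * (y * r) - (y * r) * c + c * c + a * r * (y * r - c) + b * r * r)
      identity = solve-∀ ℚ-ring

    S[y]≡0 : y * y * y + a * (y * y) + b * y + c ≡ 0ℚ
    S[y]≡0 = [ ⊥-elim ∘ *-≢0 (*-≢0 r≢0 r≢0) r≢0 , (λ S[y]≡0 → S[y]≡0) ]′ (p*q≡0⇒p≡0∨q≡0 _ _ r³S[y]≡0)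

  evenSextic-irreducible⇒resolventCubic-irreducible :
    ∀ {a b c} → c ≢ 0ℚ → Irreducible (evenSextic a b c) → Irreducible (resolventCubic a b c)
  evenSextic-irreducible⇒resolventCubic-irreducible {a} {b} {c} c≢0 (_ , sextic-irreducible) =
    (3 , s≤s z≤n , R-deg) , λ R-factorisation →
      let r , R[r]≡0 = cubic-factorisation⇒root R-deg R-factorisation
          y , S[y]≡0 = resolventCubic-root⇒cubic-root {a} {b} r c≢0 R[r]≡0
      in sextic-irreducible (cubic-root⇒evenSextic-factorisation y S[y]≡0)
    where
    R-deg : HasDegree (resolventCubic a b c) 3
    R-deg = 1≢0 , DegreeAtMost-⊕ (DegreeAtMost-⊕ (DegreeAtMost-⊕ (DegreeAtMost-mono _ ℕ.≤-refl)
                                                                (DegreeAtMost-mono _ (ℕ.n≤1+n 2)))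
                                                 (DegreeAtMost-mono _ (s≤s z≤n)))
                                  (DegreeAtMost-mono _ z≤n)

  evenSextic-a≡0 : ∀ b c → mono 1ℚ 6 ⊕ mono b 2 ⊕ mono c 0 ≗ evenSextic 0ℚ b c
  evenSextic-a≡0 b c i = cong (λ t → t + mono b 2 i + mono c 0 i) (sym (⊕-mono-zero (mono 1ℚ 6) 4 i))

  evenSextic-b≡0 : ∀ a c → mono 1ℚ 6 ⊕ mono a 4 ⊕ mono c 0 ≗ evenSextic a 0ℚ c
  evenSextic-b≡0 a c i = cong (_+ mono c 0 i) (sym (⊕-mono-zero (mono 1ℚ 6 ⊕ mono a 4) 2 i))

  resolventCubic-a≡0 : ∀ b c → resolventCubic 0ℚ b c ≗ mono 1ℚ 3 ⊕ mono (- b) 2 ⊕ mono (- (c * c)) 0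
  resolventCubic-a≡0 b c i = cong (_+ mono (- (c * c)) 0 i) (trans
    (cong (λ u → mono 1ℚ 3 i + mono (- b) 2 i + mono u 1 i) (*-zeroˡ c))
    (⊕-mono-zero (mono 1ℚ 3 ⊕ mono (- b) 2) 1 i))

  resolventCubic-b≡0 : ∀ a c → resolventCubic a 0ℚ c ≗ mono 1ℚ 3 ⊕ mono (a * c) 1 ⊕ mono (- (c * c)) 0
  resolventCubic-b≡0 a c i = cong (λ t → t + mono (a * c) 1 i + mono (- (c * c)) 0 i) (⊕-mono-zero (mono 1ℚ 3) 2 i)

  ℤ→ℚ-homo‿- : ∀ z → ℤ→ℚ (ℤ.- z) ≡ - ℤ→ℚ z
  ℤ→ℚ-homo‿- (ℤ.+ zero)  = refl
  ℤ→ℚ-homo‿- (ℤ.+ suc n) = refl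
  ℤ→ℚ-homo‿- ℤ.-[1+ n ]  = neg-involutive (ℤ→ℚ (ℤ.+ suc n))
    where
    neg-involutive : ∀ x → x ≡ - - x
    neg-involutive = solve-∀ ℚ-ring

  ℤ→ℚ-homo-* : ∀ x y → ℤ→ℚ (x ℤ.* y) ≡ ℤ→ℚ x * ℤ→ℚ y
  ℤ→ℚ-homo-* x y = toℚᵘ-injective (begin
    toℚᵘ (ℤ→ℚ (x ℤ.* y))                   ≈⟨ toℚᵘ-fromℚᵘ (ℚᵘ.mkℚᵘ (x ℤ.* y) 0) ⟩
    ℚᵘ.mkℚᵘ x 0 ℚᵘ.* ℚᵘ.mkℚᵘ y 0           ≈⟨ ℚᵘ.*-cong (toℚᵘ-fromℚᵘ (ℚᵘ.mkℚᵘ x 0)) (toℚᵘ-fromℚᵘ (ℚᵘ.mkℚᵘ y 0)) ⟨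
    toℚᵘ (ℤ→ℚ x) ℚᵘ.* toℚᵘ (ℤ→ℚ y)         ≈⟨ toℚᵘ-homo-* (ℤ→ℚ x) (ℤ→ℚ y) ⟨
    toℚᵘ (ℤ→ℚ x * ℤ→ℚ y)                   ∎)
    where open ℚᵘ.≃-Reasoning

  ℤ→ℚ-≢0 : ∀ {z} → z ≢ 0ℤ → ℤ→ℚ z ≢ 0ℚ
  ℤ→ℚ-≢0 {z} z≢0 z/1≡0 = z≢0 (begin
    z                              ≡⟨ ↥-/ z 1 ⟨
    ↥ ℤ→ℚ z ℤ.* ℤ.gcd z (ℤ.+ 1)    ≡⟨ cong (ℤ._* ℤ.gcd z (ℤ.+ 1)) (p≡0⇒↥p≡0 _ z/1≡0) ⟩
    0ℤ ℤ.* ℤ.gcd z (ℤ.+ 1)         ≡⟨ ℤ.*-zeroˡ (ℤ.gcd z (ℤ.+ 1)) ⟩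
    0ℤ                             ∎)
    where open ≡-Reasoning

  i*j≢0⇒j≢0 : ∀ i {j} → i ℤ.* j ≢ 0ℤ → j ≢ 0ℤ
  i*j≢0⇒j≢0 i i*j≢0 j≡0 = i*j≢0 (trans (cong (i ℤ.*_) j≡0) (ℤ.*-zeroʳ i))

  ĥ-constant : ∀ B → ℤ→ℚ (ℤ.- (B ℤ.^ 2)) ≡ - (ℤ→ℚ B * ℤ→ℚ B)
  ĥ-constant B = begin
    ℤ→ℚ (ℤ.- (B ℤ.^ 2))     ≡⟨ ℤ→ℚ-homo‿- (B ℤ.^ 2) ⟩
    - ℤ→ℚ (B ℤ.^ 2)         ≡⟨ cong (λ u → - ℤ→ℚ (B ℤ.* u)) (ℤ.*-identityʳ B) ⟩
    - ℤ→ℚ (B ℤ.* B)         ≡⟨ cong -_ (ℤ→ℚ-homo-* B B) ⟩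
    - (ℤ→ℚ B * ℤ→ℚ B)       ∎
    where open ≡-Reasoning

  ĥ₁-coefficient : ∀ A B → ℤ→ℚ ((ℤ.- 1ℤ) ℤ.^ 1 ℤ.* A ℤ.* B ℤ.^ 0) ≡ - ℤ→ℚ A
  ĥ₁-coefficient A B =
    trans (cong ℤ→ℚ (trans (ℤ.*-identityʳ (ℤ.-1ℤ ℤ.* A)) (ℤ.-1*i≡-i A))) (ℤ→ℚ-homo‿- A)

  ĥ₂-coefficient : ∀ A B → ℤ→ℚ ((ℤ.- 1ℤ) ℤ.^ 2 ℤ.* A ℤ.* B ℤ.^ 1) ≡ ℤ→ℚ A * ℤ→ℚ B
  ĥ₂-coefficient A B =
    trans (cong ℤ→ℚ (cong₂ ℤ._*_ (ℤ.*-identityˡ A) (ℤ.*-identityʳ B))) (ℤ→ℚ-homo-* A B)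

  resolventCubic≗ĥ₁ : ∀ A B → resolventCubic 0ℚ (ℤ→ℚ A) (ℤ→ℚ B) ≗
    mono 1ℚ 3 ⊕ mono (ℤ→ℚ ((ℤ.- 1ℤ) ℤ.^ 1 ℤ.* A ℤ.* B ℤ.^ 0)) 2 ⊕ mono (ℤ→ℚ (ℤ.- (B ℤ.^ 2))) 0
  resolventCubic≗ĥ₁ A B i = trans (resolventCubic-a≡0 (ℤ→ℚ A) (ℤ→ℚ B) i)
    (cong₂ (λ u v → mono 1ℚ 3 i + mono u 2 i + mono v 0 i) (sym (ĥ₁-coefficient A B)) (sym (ĥ-constant B)))

  resolventCubic≗ĥ₂ : ∀ A B → resolventCubic (ℤ→ℚ A) 0ℚ (ℤ→ℚ B) ≗
    mono 1ℚ 3 ⊕ mono (ℤ→ℚ ((ℤ.- 1ℤ) ℤ.^ 2 ℤ.* A ℤ.* B ℤ.^ 1)) 1 ⊕ mono (ℤ→ℚ (ℤ.- (B ℤ.^ 2))) 0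
  resolventCubic≗ĥ₂ A B i = trans (resolventCubic-b≡0 (ℤ→ℚ A) (ℤ→ℚ B) i)
    (cong₂ (λ u v → mono 1ℚ 3 i + mono u 1 i + mono v 0 i) (sym (ĥ₂-coefficient A B)) (sym (ĥ-constant B)))

open import Data.Integer using (_*_; _^_; -_)
open import Data.Nat using (ℕ; _∸_)
open import Data.Rational using (1ℚ)

lemma2p1 : (A B : ℤ) → A * B ≢ 0ℤ → (k : ℕ) → (k ≡ 1 ⊎ k ≡ 2) →
    Irreducible (mono 1ℚ 6 ⊕ mono (ℤ→ℚ A) (2 Data.Nat.* k) ⊕ mono (ℤ→ℚ B) 0) →
    Irreducible (mono 1ℚ 3 ⊕ mono (ℤ→ℚ (((- 1ℤ) ^ k) * A * (B ^ (k ∸ 1)))) (3 ∸ k) ⊕ mono (ℤ→ℚ (- (B ^ 2))) 0)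
lemma2p1 A B AB≢0 _ (inj₁ refl) =
  Irreducible-resp-≗ (resolventCubic≗ĥ₁ A B) ∘
  evenSextic-irreducible⇒resolventCubic-irreducible (ℤ→ℚ-≢0 (i*j≢0⇒j≢0 A AB≢0)) ∘
  Irreducible-resp-≗ (evenSextic-a≡0 (ℤ→ℚ A) (ℤ→ℚ B))
lemma2p1 A B AB≢0 _ (inj₂ refl) =
  Irreducible-resp-≗ (resolventCubic≗ĥ₂ A B) ∘
  evenSextic-irreducible⇒resolventCubic-irreducible (ℤ→ℚ-≢0 (i*j≢0⇒j≢0 A AB≢0)) ∘
  Irreducible-resp-≗ (evenSextic-b≡0 (ℤ→ℚ A) (ℤ→ℚ B))
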